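{- Let $n\ge4$ and $k\ge1$ be integers. Then \[ \gamma_{[k]R}(C_7\Box P_n)\le 7(n-2)\left\lceil\frac{k+4}{5}\right\rceil+14\left\lceil\frac{k+3-\left\lceil\frac{k+4}{5}\right\rceil}{3}\right\rceil . \]
   Context: For a graph $G$ and $v\in V(G)$, $N(v)$ is the open neighborhood and $N[v]=N(v)\cup\{v\}$. For an integer $k\ge1$, a function $f:V(G)\to\{0,1,\dots,k+1\}$ is a $[k]$-Roman dominating function if for every vertex $v$ with $f(v)<k$ we have $\sum_{u\in N[v]}f(u)\ge k+|\{u\in N(v): f(u)>0\}|$. The weight of $f$ is $\sum_{v}f(v)$, and $\gamma_{[k]R}(G)$ is the minimum weight of a $[k]$-Roman dominating function on $G$. $C_m\Box P_n$ is the Cartesian product of the cycle $C_m$ (vertices $0,\dots,m-1$ mod $m$) and the path $P_n$ (vertices $0,\dots,n-1$): $(i,j)\sim(i',j')$ iff ($i=i'$ and $|j-j'|=1$) or ($j=j'$ and $i'\equiv i\pm1 \pmod m$). -}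

module Defs where

open import Data.Nat using (ℕ; zero; suc; _+_; _*_; _∸_; _≤_; _<_; _/_; _%_)
open import Data.Fin using (Fin; toℕ)
open import Data.Product using (_×_; Σ; _,_)
open import Data.Sum using (_⊎_)
open import Relation.Binary.PropositionalEquality using (_≡_)
open import Relation.Nullary using (Dec; yes; no)
open import Data.Nat using (_≟_)
open import Relation.Nullary.Decidable using (_×-dec_; _⊎-dec_)
import Data.Fin as F

sumFin : (n : ℕ) → (Fin n → ℕ) → ℕ
sumFin zero    g = 0
sumFin (suc n) g = g Data.Fin.zero + sumFin n (λ i → g (Data.Fin.suc i))

-- Vertices of C_m □ P_n : pairs (i , j), i ∈ Z_m (cycle), j ∈ {0..n-1} (path)
Vertex : ℕ → ℕ → Set
Vertex m n = Fin m × Fin n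

CycAdj : (m : ℕ) → Fin m → Fin m → Set
CycAdj m i i' = (toℕ i' ≡ (toℕ i + 1) % suc (m ∸ 1)) ⊎ (toℕ i ≡ (toℕ i' + 1) % suc (m ∸ 1))

PathAdj : (n : ℕ) → Fin n → Fin n → Set
PathAdj n j j' = (toℕ j' ≡ suc (toℕ j)) ⊎ (toℕ j ≡ suc (toℕ j'))

Adj : (m n : ℕ) → Vertex m n → Vertex m n → Set
Adj m n (i , j) (i' , j') = ((i ≡ i') × PathAdj n j j') ⊎ ((j ≡ j') × CycAdj m i i')

adj? : (m n : ℕ) → (u v : Vertex m n) → Dec (Adj m n u v)
adj? m n (i , j) (i' , j') =
  ((i F.≟ i') ×-dec ((toℕ j' ≟ suc (toℕ j)) ⊎-dec (toℕ j ≟ suc (toℕ j'))))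
    ⊎-dec ((j F.≟ j') ×-dec ((toℕ i' ≟ (toℕ i + 1) % suc (m ∸ 1)) ⊎-dec (toℕ i ≟ (toℕ i' + 1) % suc (m ∸ 1))))

Labeling : ℕ → ℕ → Set
Labeling m n = Vertex m n → ℕ

sumV : (m n : ℕ) → (Vertex m n → ℕ) → ℕ
sumV m n g = sumFin m (λ i → sumFin n (λ j → g (i , j)))

nbSum : (m n : ℕ) → Labeling m n → Vertex m n → ℕ
nbSum m n f v = sumV m n (λ u → if? (adj? m n v u) (f u))
  where
  if? : {A : Set} → Dec A → ℕ → ℕ
  if? (yes _) x = x
  if? (no _)  _ = 0

activeNb : (m n : ℕ) → Labeling m n → Vertex m n → ℕ
activeNb m n f v = sumV m n (λ u → ind (adj? m n v u) (f u))
  where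
  ind : {A : Set} → Dec A → ℕ → ℕ
  ind (yes _) zero    = 0
  ind (yes _) (suc _) = 1
  ind (no _)  _       = 0

weight : (m n : ℕ) → Labeling m n → ℕ
weight m n f = sumV m n f

IsKRDF : (k m n : ℕ) → Labeling m n → Set
IsKRDF k m n f =
  ((v : Vertex m n) → f v ≤ suc k) ×
  ((v : Vertex m n) → f v < k → k + activeNb m n f v ≤ f v + nbSum m n f v)

-- ceiling division ⌈a / (suc b)⌉
ceilDiv : ℕ → ℕ → ℕ
ceilDiv a b = (a + b) / suc b

{-# OPTIONS --safe #-}
-- Label the two end columns of C_m □ P_n (m ≥ 3) with b = ⌈(k + 3 − a)/3⌉ and every other vertex with
-- a = ⌈(k + 4)/5⌉, a labelling of weight m ((n − 2) a + 2 b).  Since Σ_{N(v)} f splits as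
-- |{u ∈ N(v) : f u > 0}| + Σ_{N(v)} (f ∸ 1), the [k]-condition at v follows from
-- k ≤ f v + Σ_{u ∈ N(v)} (f u ∸ 1).  An end vertex has two end neighbours on its cycle and an
-- inner one on its path, which needs k + 3 ≤ a + 3b; when n ≥ 4 an inner vertex has at most one
-- end neighbour, which needs k + 4 ≤ 5a and k + 4 ≤ 4a + b.  The first two inequalities hold by
-- the choice of a and b, and for k ≥ 1 they imply the third.
module Submission where

open import Defs
open import Data.Nat using (ℕ; _+_; _*_; _∸_; _≤_)
open import Data.Product using (Σ; _×_)

open import Data.Nat using (zero; suc; _<_; NonZero; s≤s; s≤s⁻¹; z≤n)
open import Data.Nat.DivMod
open import Data.Nat.Properties
open import Data.Nat.Tactic.RingSolver using (solve-∀)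
open import Data.Fin using (Fin; zero; suc; toℕ; fromℕ; fromℕ<; inject₁; punchOut)
open import Data.Fin.Properties using (toℕ-fromℕ<; toℕ<n; toℕ-fromℕ; toℕ-inject₁; punchIn-punchOut; punchOut-injective)
open import Data.Product using (∃; ∃₂; _,_)
open import Data.Sum using (_⊎_; inj₁; inj₂)
open import Data.Bool using (if_then_else_)
open import Data.Vec.Functional using (removeAt)
open import Function using (_∘_)
open import Relation.Nullary using (Dec; yes; no; ¬_; does; contradiction)
open import Relation.Nullary.Decidable using (_⊎-dec_; dec-true; dec-false)
open import Relation.Binary.PropositionalEquality

open import Algebra.Properties.CommutativeMonoid.Sum +-0-commutativeMonoid
  using (sum; sum-remove; ∑-distrib-+; sum-init-last)

sumFin≡sum : ∀ n (t : Fin n → ℕ) → sumFin n t ≡ sum t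
sumFin≡sum zero    t = refl
sumFin≡sum (suc n) t = cong (t zero +_) (sumFin≡sum n (t ∘ suc))

sumFin-cong : ∀ n {s t : Fin n → ℕ} → (∀ i → s i ≡ t i) → sumFin n s ≡ sumFin n t
sumFin-cong zero    eq = refl
sumFin-cong (suc n) eq = cong₂ _+_ (eq zero) (sumFin-cong n (eq ∘ suc))

sumFin-+ : ∀ n (s t : Fin n → ℕ) → sumFin n (λ i → s i + t i) ≡ sumFin n s + sumFin n t
sumFin-+ n s t = begin
  sumFin n (λ i → s i + t i) ≡⟨ sumFin≡sum n _ ⟩
  sum (λ i → s i + t i)      ≡⟨ ∑-distrib-+ s t ⟩
  sum s + sum t              ≡⟨ sym (cong₂ _+_ (sumFin≡sum n s) (sumFin≡sum n t)) ⟩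
  sumFin n s + sumFin n t    ∎
  where open ≡-Reasoning

sumFin-const : ∀ n c → sumFin n (λ _ → c) ≡ n * c
sumFin-const zero    c = refl
sumFin-const (suc n) c = cong (c +_) (sumFin-const n c)

sumFin-init-last : ∀ n (t : Fin (suc n) → ℕ) → sumFin (suc n) t ≡ sumFin n (t ∘ inject₁) + t (fromℕ n)
sumFin-init-last n t = begin
  sumFin (suc n) t                   ≡⟨ sumFin≡sum (suc n) t ⟩
  sum t                              ≡⟨ sum-init-last t ⟩
  sum (t ∘ inject₁) + t (fromℕ n)    ≡⟨ cong (_+ t (fromℕ n)) (sym (sumFin≡sum n _)) ⟩
  sumFin n (t ∘ inject₁) + t (fromℕ n) ∎
  where open ≡-Reasoning

sumFin-remove : ∀ n (t : Fin (suc n) → ℕ) i → sumFin (suc n) t ≡ t i + sumFin n (removeAt t i)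
sumFin-remove n t i = begin
  sumFin (suc n) t                ≡⟨ sumFin≡sum (suc n) t ⟩
  sum t                           ≡⟨ sum-remove t ⟩
  t i + sum (removeAt t i)        ≡⟨ cong (t i +_) (sym (sumFin≡sum n _)) ⟩
  t i + sumFin n (removeAt t i)   ∎
  where open ≡-Reasoning

≤-sumFin : ∀ n (t : Fin n → ℕ) i → t i ≤ sumFin n t
≤-sumFin (suc n) t i = subst (t i ≤_) (sym (sumFin-remove n t i)) (m≤m+n _ _)

removeAt-punchOut : ∀ {n} (t : Fin (suc n) → ℕ) {i j} (i≢j : i ≢ j) → removeAt t i (punchOut i≢j) ≡ t j
removeAt-punchOut t i≢j = cong t (punchIn-punchOut i≢j)

≤-sumFin₂ : ∀ n (t : Fin n → ℕ) {i j} → i ≢ j → t i + t j ≤ sumFin n t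
≤-sumFin₂ (suc n) t {i} {j} i≢j = begin
  t i + t j                                  ≡⟨ cong (t i +_) (sym (removeAt-punchOut t i≢j)) ⟩
  t i + removeAt t i (punchOut i≢j)          ≤⟨ +-monoʳ-≤ (t i) (≤-sumFin n (removeAt t i) _) ⟩
  t i + sumFin n (removeAt t i)              ≡⟨ sym (sumFin-remove n t i) ⟩
  sumFin (suc n) t                           ∎
  where open ≤-Reasoning

≤-sumFin₃ : ∀ n (t : Fin n → ℕ) {i j l} → i ≢ j → i ≢ l → j ≢ l → t i + t j + t l ≤ sumFin n t
≤-sumFin₃ (suc n) t {i} {j} {l} i≢j i≢l j≢l = begin
  t i + t j + t l                           ≡⟨ +-assoc (t i) (t j) (t l) ⟩
  t i + (t j + t l)                         ≡⟨ sym (cong (t i +_) (cong₂ _+_ (removeAt-punchOut t i≢j) (removeAt-punchOut t i≢l))) ⟩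
  t i + (t′ (punchOut i≢j) + t′ (punchOut i≢l)) ≤⟨ +-monoʳ-≤ (t i) (≤-sumFin₂ n t′ (j≢l ∘ punchOut-injective i≢j i≢l)) ⟩
  t i + sumFin n t′                         ≡⟨ sym (sumFin-remove n t i) ⟩
  sumFin (suc n) t                          ∎
  where
  open ≤-Reasoning
  t′ : Fin n → ℕ
  t′ = removeAt t i

when : ∀ {A : Set} → Dec A → ℕ → ℕ
when (yes _) x = x
when (no _)  _ = 0

when-yes : ∀ {A : Set} (d : Dec A) {x} → A → when d x ≡ x
when-yes (yes _) _  = refl
when-yes (no ¬a) a  = contradiction a ¬a

sumV-pointwise-+ : ∀ {m n} {s t u : Vertex m n → ℕ} → (∀ v → s v ≡ t v + u v) →
  sumV m n s ≡ sumV m n t + sumV m n u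
sumV-pointwise-+ {m} {n} {s} {t} {u} eq = begin
  sumV m n s                                                  ≡⟨ sumFin-cong m (λ i → sumFin-cong n (λ j → eq (i , j))) ⟩
  sumFin m (λ i → sumFin n (λ j → t (i , j) + u (i , j)))      ≡⟨ sumFin-cong m (λ i → sumFin-+ n _ _) ⟩
  sumFin m (λ i → sumFin n (λ j → t (i , j)) + sumFin n (λ j → u (i , j))) ≡⟨ sumFin-+ m _ _ ⟩
  sumV m n t + sumV m n u                                     ∎
  where open ≡-Reasoning

-- The summands of nbSum and activeNb are local functions of Defs and cannot be named here,
-- so the pointwise facts about them get their types by unification with the uses below.
mutual
  nbSum-split : ∀ m n (f : Labeling m n) v →
    nbSum m n f v ≡ activeNb m n f v + nbSum m n (λ u → f u ∸ 1) v
  nbSum-split m n f v = sumV-pointwise-+ (split-summand m n f v)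

  nbSum≡sumV-when : ∀ m n (f : Labeling m n) v →
    nbSum m n f v ≡ sumV m n (λ u → when (adj? m n v u) (f u))
  nbSum≡sumV-when m n f v = sumFin-cong m (λ i → sumFin-cong n (λ j → when-summand m n f v (i , j)))

  private
    split-summand : ∀ m n (f : Labeling m n) v u → _
    split-summand m n f v u with adj? m n v u | f u
    ... | yes _ | zero  = refl
    ... | yes _ | suc _ = refl
    ... | no _  | _     = refl

    when-summand : ∀ m n (f : Labeling m n) v u → _
    when-summand m n f v u with adj? m n v u
    ... | yes _ = refl
    ... | no _  = refl

pred-condition⇒IsKRDF : ∀ {k m n} (f : Labeling m n) → (∀ v → f v ≤ suc k) →
  (∀ v → k ≤ f v + nbSum m n (λ u → f u ∸ 1) v) → IsKRDF k m n f
pred-condition⇒IsKRDF {k} {m} {n} f f≤1+k condition = f≤1+k , λ v _ → begin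
  k + activeNb m n f v                        ≤⟨ +-monoˡ-≤ (activeNb m n f v) (condition v) ⟩
  f v + nbSum m n f∸1 v + activeNb m n f v    ≡⟨ +-assoc (f v) _ _ ⟩
  f v + (nbSum m n f∸1 v + activeNb m n f v)  ≡⟨ cong (f v +_) (+-comm _ (activeNb m n f v)) ⟩
  f v + (activeNb m n f v + nbSum m n f∸1 v)  ≡⟨ cong (f v +_) (sym (nbSum-split m n f v)) ⟩
  f v + nbSum m n f v                         ∎
  where
  open ≤-Reasoning
  f∸1 : Labeling m n
  f∸1 u = f u ∸ 1

[x+d]%m≡x⇒d≡0 : ∀ {m} x {d} .{{_ : NonZero m}} → d < m → (x + d) % m ≡ x → d ≡ 0
[x+d]%m≡x⇒d≡0 {m} x {d} d<m eq = multiple<m⇒0 ((x + d) / m) d≡q*m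
  where
  d≡q*m : d ≡ (x + d) / m * m
  d≡q*m = +-cancelˡ-≡ x d _ (trans (m≡m%n+[m/n]*n (x + d) m) (cong (_+ (x + d) / m * m) eq))
  multiple<m⇒0 : ∀ q → d ≡ q * m → d ≡ 0
  multiple<m⇒0 zero    d≡0     = d≡0
  multiple<m⇒0 (suc q) d≡m+q*m = contradiction d<m (≤⇒≯ (subst (m ≤_) (sym d≡m+q*m) (m≤m+n m (q * m))))

[x%m+y]%m≡[x+y]%m : ∀ x y m .{{_ : NonZero m}} → (x % m + y) % m ≡ (x + y) % m
[x%m+y]%m≡[x+y]%m x y m = begin
  (x % m + y) % m            ≡⟨ %-distribˡ-+ (x % m) y m ⟩
  (x % m % m + y % m) % m    ≡⟨ cong (λ r → (r + y % m) % m) (m%n%n≡m%n x m) ⟩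
  (x % m + y % m) % m        ≡⟨ sym (%-distribˡ-+ x y m) ⟩
  (x + y) % m                ∎
  where open ≡-Reasoning

toℕ-mod : ∀ x m .{{_ : NonZero m}} → toℕ (x mod m) ≡ x % m
toℕ-mod x m = toℕ-fromℕ< (m%n<n x m)

record CycleNeighbours (m : ℕ) (i : Fin m) : Set where
  field
    left right     : Fin m
    left-adjacent  : CycAdj m i left
    right-adjacent : CycAdj m i right
    left≢right     : left ≢ right
    left≢i         : left ≢ i
    right≢i        : right ≢ i

cycleNeighbours : ∀ {m} → 3 ≤ m → (i : Fin m) → CycleNeighbours m i
cycleNeighbours {suc m} (s≤s 2≤m) i = record
  { left           = shift m
  ; right          = shift 1
  ; left-adjacent  = inj₂ i≡[left+1]%M
  ; right-adjacent = inj₁ (toℕ-mod (x + 1) M)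
  ; left≢right     = left≢right
  ; left≢i         = shift≢i (n<1+n m) (<⇒≢ 0<m ∘ sym)
  ; right≢i        = shift≢i (s≤s 0<m) λ ()
  }
  where
  M x : ℕ
  M = suc m
  x = toℕ i

  0<m : 0 < m
  0<m = <-trans (s≤s z≤n) 2≤m

  shift : ℕ → Fin M
  shift d = (x + d) mod M

  shift≢i : ∀ {d} → d < M → d ≢ 0 → shift d ≢ i
  shift≢i d<M d≢0 eq = d≢0 ([x+d]%m≡x⇒d≡0 x d<M (trans (sym (toℕ-mod (x + _) M)) (cong toℕ eq)))

  i≡[left+1]%M : x ≡ (toℕ (shift m) + 1) % M
  i≡[left+1]%M = sym (begin
    (toℕ (shift m) + 1) % M ≡⟨ cong (λ r → (r + 1) % M) (toℕ-mod (x + m) M) ⟩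
    ((x + m) % M + 1) % M   ≡⟨ [x%m+y]%m≡[x+y]%m (x + m) 1 M ⟩
    (x + m + 1) % M         ≡⟨ cong (_% M) (trans (+-assoc x m 1) (cong (x +_) (+-comm m 1))) ⟩
    (x + M) % M             ≡⟨ [m+n]%n≡m%n x M ⟩
    x % M                   ≡⟨ m<n⇒m%n≡m (toℕ<n i) ⟩
    x                       ∎)
    where open ≡-Reasoning

  left≢right : shift m ≢ shift 1
  left≢right eq = <⇒≢ (∸-monoˡ-≤ 1 2≤m) (sym ([x+d]%m≡x⇒d≡0 y (s≤s (m∸n≤m m 1)) y+[m∸1]%M≡y))
    where
    open ≡-Reasoning
    y : ℕ
    y = (x + 1) % M
    y+[m∸1]%M≡y : (y + (m ∸ 1)) % M ≡ y
    y+[m∸1]%M≡y = begin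
      (y + (m ∸ 1)) % M       ≡⟨ [x%m+y]%m≡[x+y]%m (x + 1) (m ∸ 1) M ⟩
      (x + 1 + (m ∸ 1)) % M   ≡⟨ cong (_% M) (trans (+-assoc x 1 (m ∸ 1)) (cong (x +_) (m+[n∸m]≡n 0<m))) ⟩
      (x + m) % M             ≡⟨ sym (toℕ-mod (x + m) M) ⟩
      toℕ (shift m)           ≡⟨ cong toℕ eq ⟩
      toℕ (shift 1)           ≡⟨ toℕ-mod (x + 1) M ⟩
      y                       ∎

module _ {m n : ℕ} (h : Vertex m n → ℕ) {i : Fin m} {j : Fin n} (c : CycleNeighbours m i) where
  open CycleNeighbours c

  private
    nbRow : Fin m → ℕ
    nbRow i′ = sumFin n (λ j′ → when (adj? m n (i , j) (i′ , j′)) (h (i′ , j′)))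

    when-adj : ∀ {u} → Adj m n (i , j) u → when (adj? m n (i , j) u) (h u) ≡ h u
    when-adj = when-yes (adj? m n (i , j) _)

    ≤-nbRow : ∀ {i′ j′} → Adj m n (i , j) (i′ , j′) → h (i′ , j′) ≤ nbRow i′
    ≤-nbRow {i′} {j′} adj = subst (_≤ nbRow i′) (when-adj adj) (≤-sumFin n _ j′)

    nbRows≤nbSum : nbRow left + nbRow right + nbRow i ≤ nbSum m n h (i , j)
    nbRows≤nbSum = subst (nbRow left + nbRow right + nbRow i ≤_) (sym (nbSum≡sumV-when m n h (i , j)))
                         (≤-sumFin₃ m nbRow left≢right left≢i right≢i)

    cycle≤nbRows : h (left , j) + h (right , j) ≤ nbRow left + nbRow right
    cycle≤nbRows = +-mono-≤ (≤-nbRow (inj₂ (refl , left-adjacent))) (≤-nbRow (inj₂ (refl , right-adjacent)))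

  ≤-nbSum₃ : ∀ {j₁} → PathAdj n j j₁ → h (left , j) + h (right , j) + h (i , j₁) ≤ nbSum m n h (i , j)
  ≤-nbSum₃ adj₁ = ≤-trans (+-mono-≤ cycle≤nbRows (≤-nbRow (inj₁ (refl , adj₁)))) nbRows≤nbSum

  ≤-nbSum₄ : ∀ {j₁ j₂} → j₁ ≢ j₂ → PathAdj n j j₁ → PathAdj n j j₂ →
    h (left , j) + h (right , j) + (h (i , j₁) + h (i , j₂)) ≤ nbSum m n h (i , j)
  ≤-nbSum₄ {j₁} {j₂} j₁≢j₂ adj₁ adj₂ = ≤-trans (+-mono-≤ cycle≤nbRows path≤nbRow) nbRows≤nbSum
    where
    path≤nbRow : h (i , j₁) + h (i , j₂) ≤ nbRow i
    path≤nbRow = subst₂ (λ x y → x + y ≤ nbRow i) (when-adj (inj₁ (refl , adj₁))) (when-adj (inj₁ (refl , adj₂)))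
                        (≤-sumFin₂ n _ j₁≢j₂)

IsEnd : ℕ → ℕ → Set
IsEnd n t = t ≡ 0 ⊎ suc t ≡ n

isEnd? : ∀ n t → Dec (IsEnd n t)
isEnd? n t = (t ≟ 0) ⊎-dec (suc t ≟ n)

neighbourBelow : ∀ {n t} (j : Fin n) → toℕ j ≡ suc t → Σ (Fin n) λ j′ → toℕ j′ ≡ t × PathAdj n j j′
neighbourBelow {n} {t} j eq = fromℕ< t<n , toℕ-fromℕ< t<n , inj₂ (trans eq (cong suc (sym (toℕ-fromℕ< t<n))))
  where
  t<n : t < n
  t<n = <⇒≤ (subst (_< n) eq (toℕ<n j))

neighbourAbove : ∀ {n} (j : Fin n) → suc (toℕ j) < n → Σ (Fin n) λ j′ → toℕ j′ ≡ suc (toℕ j) × PathAdj n j j′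
neighbourAbove j lt = fromℕ< lt , toℕ-fromℕ< lt , inj₁ (toℕ-fromℕ< lt)

between⇒¬IsEnd : ∀ {n s t} → s ≡ t → 0 < t → suc t < n → ¬ IsEnd n s
between⇒¬IsEnd refl 0<t 1+t<n (inj₁ t≡0)   = <⇒≢ 0<t (sym t≡0)
between⇒¬IsEnd refl 0<t 1+t<n (inj₂ 1+t≡n) = <⇒≢ 1+t<n 1+t≡n

endNeighbour : ∀ {n} → 3 ≤ n → (j : Fin n) → IsEnd n (toℕ j) →
  ∃ λ j′ → PathAdj n j j′ × ¬ IsEnd n (toℕ j′)
endNeighbour {suc n} 3≤n zero _ with neighbourAbove {suc n} zero (<⇒≤ 3≤n)
... | j′ , j′≡1 , adj = j′ , adj , between⇒¬IsEnd j′≡1 (s≤s z≤n) 3≤n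
endNeighbour _ (suc j) (inj₁ ())
endNeighbour {suc (suc (suc n))} (s≤s (s≤s (s≤s _))) (suc j) (inj₂ 2+j≡3+n) with neighbourBelow (suc j) (suc-injective 2+j≡3+n)
... | j′ , j′≡1+n , adj = j′ , adj , between⇒¬IsEnd j′≡1+n (s≤s z≤n) ≤-refl

below≢above : ∀ {n t} {j₁ j₂ : Fin n} → toℕ j₁ ≡ t → toℕ j₂ ≡ suc (suc t) → j₁ ≢ j₂
below≢above {t = t} j₁≡t j₂≡2+t j₁≡j₂ =
  <⇒≢ (m<n⇒m<1+n (n<1+n t)) (trans (sym j₁≡t) (trans (cong toℕ j₁≡j₂) j₂≡2+t))

innerNeighbours : ∀ {n} → 4 ≤ n → (j : Fin n) → ¬ IsEnd n (toℕ j) →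
  ∃₂ λ j₁ j₂ → j₁ ≢ j₂ × PathAdj n j j₁ × PathAdj n j j₂ × ¬ IsEnd n (toℕ j₁)
innerNeighbours {suc n} 4≤n zero ¬end = contradiction (inj₁ refl) ¬end
innerNeighbours {suc n} 4≤n (suc j) ¬end
  with neighbourBelow (suc j) refl | neighbourAbove (suc j) (≤∧≢⇒< (toℕ<n (suc j)) (¬end ∘ inj₂))
... | j₁ , j₁≡j , adj₁ | j₂ , j₂≡2+j , adj₂ with j
...   | zero   = j₂ , j₁ , ≢-sym (below≢above j₁≡j j₂≡2+j) , adj₂ , adj₁ , between⇒¬IsEnd j₂≡2+j (s≤s z≤n) 4≤n
...   | suc j′ = j₁ , j₂ , below≢above j₁≡j j₂≡2+j , adj₁ , adj₂ , between⇒¬IsEnd j₁≡j (s≤s z≤n) (toℕ<n (suc (suc j′)))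

column : (n a b t : ℕ) → ℕ
column n a b t = if does (isEnd? n t) then b else a

endsLabeling : ∀ {m} n (a b : ℕ) → Labeling m n
endsLabeling n a b (_ , j) = column n a b (toℕ j)

column-end : ∀ {n a b t} → IsEnd n t → column n a b t ≡ b
column-end {n} {a} {b} {t} end = cong (if_then b else a) (dec-true (isEnd? n t) end)

column-inner : ∀ {n a b t} → ¬ IsEnd n t → column n a b t ≡ a
column-inner {n} {a} {b} {t} inner = cong (if_then b else a) (dec-false (isEnd? n t) inner)

column-cases : ∀ n a b t → column n a b t ≡ a ⊎ column n a b t ≡ b
column-cases n a b t with isEnd? n t
... | yes end   = inj₂ (column-end end)
... | no ¬end   = inj₁ (column-inner ¬end)

weight-endsLabeling : ∀ m n a b → 2 ≤ n → weight m n (endsLabeling n a b) ≡ m * ((n ∸ 2) * a + 2 * b)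
weight-endsLabeling m (suc (suc n)) a b (s≤s (s≤s _)) = begin
  weight m (2 + n) (endsLabeling (2 + n) a b)                      ≡⟨ sumFin-const m _ ⟩
  m * sumFin (2 + n) col                                            ≡⟨ cong (λ s → m * (b + s)) (sumFin-init-last n (col ∘ suc)) ⟩
  m * (b + (sumFin n (col ∘ suc ∘ inject₁) + col (suc (fromℕ n))))  ≡⟨ cong (λ s → m * (b + s)) (cong₂ _+_ inner last) ⟩
  m * (b + (n * a + b))                                             ≡⟨ cong (m *_) (rearrange n a b) ⟩
  m * (n * a + 2 * b)                                               ∎
  where
  open ≡-Reasoning
  col : Fin (2 + n) → ℕ
  col j = column (2 + n) a b (toℕ j)
  inner : sumFin n (col ∘ suc ∘ inject₁) ≡ n * a
  inner = trans (sumFin-cong n (λ j → column-inner (inner-column j))) (sumFin-const n a)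
    where
    inner-column : (j : Fin n) → ¬ IsEnd (2 + n) (toℕ (suc (inject₁ j)))
    inner-column j = between⇒¬IsEnd (cong suc (toℕ-inject₁ j)) (s≤s z≤n) (s≤s (s≤s (toℕ<n j)))
  last : col (suc (fromℕ n)) ≡ b
  last = column-end (inj₂ (cong (λ t → suc (suc t)) (toℕ-fromℕ n)))
  rearrange : ∀ n a b → b + (n * a + b) ≡ n * a + 2 * b
  rearrange = solve-∀

end-arith : ∀ {k a b} → 1 ≤ a → 1 ≤ b → k + 3 ≤ a + b * 3 → k ≤ b + (b ∸ 1 + (b ∸ 1) + (a ∸ 1))
end-arith {k} {suc a} {suc b} _ _ h = +-cancelʳ-≤ 3 k _ (subst (k + 3 ≤_) (rearrange a b) h)
  where
  rearrange : ∀ a b → suc a + suc b * 3 ≡ suc b + (b + b + a) + 3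
  rearrange = solve-∀

inner-arith : ∀ {k a b x} → 1 ≤ a → 1 ≤ b → k + 4 ≤ a * 5 → k + 4 ≤ a * 4 + b → x ≡ a ⊎ x ≡ b →
  k ≤ a + (a ∸ 1 + (a ∸ 1) + (a ∸ 1 + (x ∸ 1)))
inner-arith {k} {suc a} _ _ h _ (inj₁ refl) = +-cancelʳ-≤ 4 k _ (subst (k + 4 ≤_) (rearrange a) h)
  where
  rearrange : ∀ a → suc a * 5 ≡ suc a + (a + a + (a + a)) + 4
  rearrange = solve-∀
inner-arith {k} {suc a} {suc b} _ _ _ h (inj₂ refl) = +-cancelʳ-≤ 4 k _ (subst (k + 4 ≤_) (rearrange a b) h)
  where
  rearrange : ∀ a b → suc a * 4 + suc b ≡ suc a + (a + a + (a + b)) + 4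
  rearrange = solve-∀

-- 15 (4a + b) = 11 (5a) + 5 (a + 3b) ≥ 11 (k + 4) + 5 (k + 3), which is ≥ 15 (k + 4) as soon as k ≥ 1.
mixed-bound : ∀ {k a b} → 1 ≤ k → k + 4 ≤ a * 5 → k + 3 ≤ a + b * 3 → k + 4 ≤ a * 4 + b
mixed-bound {suc k} {a} {b} _ h₅ h₃ = *-cancelˡ-≤ 15 (begin
  15 * (suc k + 4)                        ≤⟨ m≤n+m _ k ⟩
  k + 15 * (suc k + 4)                    ≡⟨ expand k ⟩
  11 * (suc k + 4) + 5 * (suc k + 3)      ≤⟨ +-mono-≤ (*-monoʳ-≤ 11 h₅) (*-monoʳ-≤ 5 h₃) ⟩
  11 * (a * 5) + 5 * (a + b * 3)          ≡⟨ collect a b ⟩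
  15 * (a * 4 + b)                        ∎)
  where
  open ≤-Reasoning
  expand : ∀ k → k + 15 * (suc k + 4) ≡ 11 * (suc k + 4) + 5 * (suc k + 3)
  expand = solve-∀
  collect : ∀ a b → 11 * (a * 5) + 5 * (a + b * 3) ≡ 15 * (a * 4 + b)
  collect = solve-∀

module _ {k m n a b : ℕ} (3≤m : 3 ≤ m) (4≤n : 4 ≤ n) (1≤a : 1 ≤ a) (1≤b : 1 ≤ b)
         (k+4≤a*5 : k + 4 ≤ a * 5) (k+4≤a*4+b : k + 4 ≤ a * 4 + b) (k+3≤a+b*3 : k + 3 ≤ a + b * 3) where

  private
    f : Labeling m n
    f = endsLabeling n a b

    f∸1 : Labeling m n
    f∸1 u = f u ∸ 1

  -- Labels depend only on the column, so f∸1 (left , j) and f∸1 (right , j) are f∸1 (i , j).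
  end-condition : ∀ i j → IsEnd n (toℕ j) → k ≤ f (i , j) + nbSum m n f∸1 (i , j)
  end-condition i j end with endNeighbour (<⇒≤ 4≤n) j end
  ... | j₁ , adj₁ , inner₁ = ≤-trans bound (+-monoʳ-≤ (f (i , j)) (≤-nbSum₃ f∸1 (cycleNeighbours 3≤m i) adj₁))
    where
    bound : k ≤ f (i , j) + (f∸1 (i , j) + f∸1 (i , j) + f∸1 (i , j₁))
    bound = subst₂ (λ x y → k ≤ x + (x ∸ 1 + (x ∸ 1) + (y ∸ 1))) (sym (column-end end)) (sym (column-inner inner₁))
                   (end-arith 1≤a 1≤b k+3≤a+b*3)

  inner-condition : ∀ i j → ¬ IsEnd n (toℕ j) → k ≤ f (i , j) + nbSum m n f∸1 (i , j)
  inner-condition i j inner with innerNeighbours 4≤n j inner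
  ... | j₁ , j₂ , j₁≢j₂ , adj₁ , adj₂ , inner₁ =
    ≤-trans bound (+-monoʳ-≤ (f (i , j)) (≤-nbSum₄ f∸1 (cycleNeighbours 3≤m i) j₁≢j₂ adj₁ adj₂))
    where
    bound : k ≤ f (i , j) + (f∸1 (i , j) + f∸1 (i , j) + (f∸1 (i , j₁) + f∸1 (i , j₂)))
    bound = subst₂ (λ x y → k ≤ x + (x ∸ 1 + (x ∸ 1) + (y ∸ 1 + f∸1 (i , j₂))))
                   (sym (column-inner inner)) (sym (column-inner inner₁))
                   (inner-arith 1≤a 1≤b k+4≤a*5 k+4≤a*4+b (column-cases n a b (toℕ j₂)))

  endsLabeling-isKRDF : a ≤ suc k → b ≤ suc k → IsKRDF k m n f
  endsLabeling-isKRDF a≤1+k b≤1+k = pred-condition⇒IsKRDF f bounded condition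
    where
    bounded : ∀ v → f v ≤ suc k
    bounded (_ , j) with column-cases n a b (toℕ j)
    ... | inj₁ fv≡a = subst (_≤ suc k) (sym fv≡a) a≤1+k
    ... | inj₂ fv≡b = subst (_≤ suc k) (sym fv≡b) b≤1+k
    condition : ∀ v → k ≤ f v + nbSum m n f∸1 v
    condition (i , j) with isEnd? n (toℕ j)
    ... | yes end   = end-condition i j end
    ... | no ¬end   = inner-condition i j ¬end

ceilDiv-spec : ∀ x q → x ≤ ceilDiv x q * suc q
ceilDiv-spec x q = +-cancelʳ-≤ q x _ (begin
  x + q                                        ≡⟨ m≡m%n+[m/n]*n (x + q) (suc q) ⟩
  (x + q) % suc q + (x + q) / suc q * suc q    ≤⟨ +-monoˡ-≤ _ (s≤s⁻¹ (m%n<n (x + q) (suc q))) ⟩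
  q + (x + q) / suc q * suc q                  ≡⟨ +-comm q _ ⟩
  (x + q) / suc q * suc q + q                  ∎)
  where open ≤-Reasoning

ceilDiv-least : ∀ {x q c} → x ≤ c * suc q → ceilDiv x q ≤ c
ceilDiv-least {x} {q} {c} x≤c[1+q] = s≤s⁻¹ (m<n*o⇒m/o<n (begin-strict
  x + q             ≤⟨ +-monoˡ-≤ q x≤c[1+q] ⟩
  c * suc q + q     <⟨ +-monoʳ-< (c * suc q) (n<1+n q) ⟩
  c * suc q + suc q ≡⟨ +-comm (c * suc q) (suc q) ⟩
  suc c * suc q     ∎))
  where open ≤-Reasoning

ceilDiv-pos : ∀ {x} q → 1 ≤ x → 1 ≤ ceilDiv x q
ceilDiv-pos q 1≤x = m≥n⇒m/n>0 (+-monoˡ-≤ q 1≤x)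

module Labels (k : ℕ) where

  a b : ℕ
  a = ceilDiv (k + 4) 4
  b = ceilDiv (k + 3 ∸ a) 2

  k+4≤a*5 : k + 4 ≤ a * 5
  k+4≤a*5 = ceilDiv-spec (k + 4) 4

  k+3≤a+b*3 : k + 3 ≤ a + b * 3
  k+3≤a+b*3 = ≤-trans (m≤n+m∸n (k + 3) a) (+-monoʳ-≤ a (ceilDiv-spec (k + 3 ∸ a) 2))

  1≤a : 1 ≤ a
  1≤a = ceilDiv-pos 4 (≤-trans (s≤s z≤n) (m≤n+m 4 k))

  a≤1+k : a ≤ suc k
  a≤1+k = ceilDiv-least (subst (k + 4 ≤_) (expand k) (m≤m+n (k + 4) (k * 4 + 1)))
    where
    expand : ∀ k → k + 4 + (k * 4 + 1) ≡ suc k * 5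
    expand = solve-∀

  1≤b : 1 ≤ b
  1≤b = ceilDiv-pos 2 (≤-trans 1≤2 (∸-monoʳ-≤ (k + 3) a≤1+k))
    where
    1≤2 : 1 ≤ k + 3 ∸ suc k
    1≤2 = subst (1 ≤_) (sym (trans (cong (_∸ suc k) (+-comm k 3)) (m+n∸n≡m 2 (suc k)))) (s≤s z≤n)

  b≤1+k : b ≤ suc k
  b≤1+k = ceilDiv-least (≤-trans (m∸n≤m (k + 3) a) (subst (k + 3 ≤_) (expand k) (m≤m+n (k + 3) (k * 2))))
    where
    expand : ∀ k → k + 3 + k * 2 ≡ suc k * 3
    expand = solve-∀

theorem15 : (n k : ℕ) → 4 ≤ n → 1 ≤ k →
    Σ (Labeling 7 n) λ f → IsKRDF k 7 n f ×
      (weight 7 n f ≤ 7 * (n ∸ 2) * ceilDiv (k + 4) 4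
                       + 14 * ceilDiv (k + 3 ∸ ceilDiv (k + 4) 4) 2)
theorem15 n k 4≤n 1≤k =
  endsLabeling n a b ,
  endsLabeling-isKRDF 3≤7 4≤n 1≤a 1≤b k+4≤a*5 (mixed-bound {b = b} 1≤k k+4≤a*5 k+3≤a+b*3) k+3≤a+b*3 a≤1+k b≤1+k ,
  ≤-reflexive (trans (weight-endsLabeling 7 n a b (≤-trans (s≤s (s≤s z≤n)) 4≤n)) (distribute (n ∸ 2) a b))
  where
  open Labels k
  3≤7 : 3 ≤ 7
  3≤7 = s≤s (s≤s (s≤s z≤n))
  distribute : ∀ n a b → 7 * (n * a + 2 * b) ≡ 7 * n * a + 14 * b
  distribute = solve-∀
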